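{- Let $k\ge2$ and let $T$ be a tree of order $n$ obtained from the path $P_{2k}=v_1v_2\cdots v_{2k}$ by attaching $n-2k$ pendent vertices to some vertices of $P_{2k}$ other than $v_2$. If at most $\frac{n-2k+1}{k}$ pendent vertices are attached to $v_1$, then $$\mu(T) < k+\frac12+\frac{4(k-1)}{k^2}.$$
   Context: Attaching a pendent vertex to a vertex $x$ means adding a new vertex adjacent only to $x$. For a connected graph $H$ on $n$ vertices, the average distance is $\mu(H)=\binom{n}{2}^{ -1}\sum_{\{u,v\}\subset V(H)} d_H(u,v)$, where $d_H$ is the distance in $H$. -}

module Defs where

open import Data.Nat using (ℕ; zero; suc; _+_; _*_; _∸_; _≡ᵇ_)
open import Data.Nat.Combinatorics using (_C_)
open import Data.Bool using (Bool; true; false; _∧_; _∨_; not; if_then_else_)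
open import Data.Fin using (Fin; toℕ; splitAt)
open import Data.Fin.Properties using (_≟_)
open import Data.Sum using (inj₁; inj₂)
open import Data.List using (List; []; _∷_; map; allFin; upTo)
open import Data.Nat.ListAction using (sum)
open import Data.Bool.ListAction using (any)
open import Data.Integer using (+_)
open import Data.Rational using (ℚ; 0ℚ; _/_)
open import Relation.Nullary.Decidable using (⌊_⌋)

-- Natural-number fraction a / b in ℚ (only used with b ≥ 1; b = 0 gives 0).
_//_ : ℕ → ℕ → ℚ
a // zero  = 0ℚ
a // suc b = (+ a) / suc b

Graph : ℕ → Set
Graph N = Fin N → Fin N → Bool

reach : ∀ {N} → Graph N → ℕ → Fin N → Fin N → Bool
reach G zero    u v = ⌊ u ≟ v ⌋
reach G (suc s) u v = reach G s u v ∨ any (λ w → reach G s u w ∧ G w v) (allFin _)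

-- Graph distance d_G(u,v) = least s with reach G s u v, i.e. the number of
-- s ∈ {0,…,N-1} with ¬ reach G s u v (correct for connected graphs, where
-- every distance is < N).
dist : ∀ {N} → Graph N → Fin N → Fin N → ℕ
dist {N} G u v = sum (map (λ s → if reach G s u v then 0 else 1) (upTo N))

wiener : ∀ {N} → Graph N → ℕ
wiener {N} G =
  sum (map (λ u → sum (map (λ v → if ⌊ Data.Nat._<?_ (toℕ u) (toℕ v) ⌋ then dist G u v else 0)
                           (allFin N)))
           (allFin N))

μ : ∀ {N} → Graph N → ℚ
μ {N} G = wiener G // (N C 2)

absDiff : ℕ → ℕ → ℕ
absDiff a b = (a ∸ b) + (b ∸ a)

-- The tree obtained from the path P_{2k} = v₁ v₂ ⋯ v_{2k} by attaching m
-- pendent vertices; pendent vertex t is attached to path vertex h t.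
-- Vertices: Fin (2k + m); the first 2k are the path vertices (index i is
-- v_{i+1}), the remaining m are the pendent vertices.
pendantTree : (k m : ℕ) → (Fin m → Fin (2 * k)) → Graph (2 * k + m)
pendantTree k m h x y with splitAt (2 * k) x | splitAt (2 * k) y
... | inj₁ i | inj₁ j = absDiff (toℕ i) (toℕ j) ≡ᵇ 1
... | inj₁ i | inj₂ t = ⌊ h t ≟ i ⌋
... | inj₂ t | inj₁ i = ⌊ h t ≟ i ⌋
... | inj₂ s | inj₂ t = false

attachedTo : ∀ {k m} → (Fin m → Fin (2 * k)) → ℕ → ℕ
attachedTo {m = m} h i = sum (map (λ t → if toℕ (h t) ≡ᵇ i then 1 else 0) (allFin m))

{-# OPTIONS --safe #-}
module Submission where

-- Index the path v₁ ⋯ v_{2k} by 0 ⋯ 2k − 1 and give each vertex u its position x(u) (that of its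
-- attachment vertex if u is pendent) and its depth e(u) ∈ {0, 1}, so that
-- d(u,v) ≤ b(u,v) := e(u) + |x(u) − x(v)| + e(v).  Routing through the centre c = v₃,
-- b(u,v) = b(u,c) + b(v,c) − 2s(u,v), where s(u,v) counts the edges shared by the two geodesics to c:
-- indicators of x = 0 and of x ≤ 1 on the side of v₁, and min(x(u) − 2, x(v) − 2), which is at least
-- (x(u) − 2)(x(v) − 2)/(2k − 3), beyond c.  Summing over all ordered pairs, with P₀ = a + 1 and P₁ = a + 2
-- the numbers of vertices at positions 0 and ≤ 1 (a pendent vertices at v₁, none at v₂) and Y = Σ (x − 2)⁺,
--   (2k − 3)·ΣΣ b + 2(2k − 3)(P₀² + P₁²) + 2Y² ≤ 2(2k − 3)·n·(Y + P₀ + P₁ + m).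
-- As ΣΣ b ≥ 2W for the Wiener index W, eliminating Y by AM–GM leaves
-- 4W ≤ (2k − 3)n² + 4n(P₀ + P₁ + m) − 4(P₀² + P₁²), and since μ = 2W/(n(n − 1)) the claim becomes a
-- polynomial inequality in k, a and m that holds whenever k·a ≤ m + 1.

-- ℕ's _<_ stays inside this block, so that _<_ is ℚ's in the statement of lemma5p4.
module _ where
  open import Defs
  open import Data.Nat.Properties
  open import Algebra.Properties.Semiring.Sum +-*-semiring
    using (sum; sum-syntax; sum-cong-≗; sum-replicate-zero; ∑-distrib-+; ∑-comm; *-distribˡ-sum; *-distribʳ-sum)
  open import Data.Bool using (true; false; T; if_then_else_)
  open import Data.Bool.Properties using (T-∨; T-∧)
  open import Data.Fin using (Fin; zero; suc; toℕ; splitAt; join; fromℕ<; _↑ˡ_; _↑ʳ_)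
  open import Data.Fin.Properties using (toℕ-injective; toℕ<n; toℕ-fromℕ<; splitAt-↑ˡ; splitAt-↑ʳ; join-splitAt)
  open import Data.Integer as ℤ using (+<+)
  open import Data.Integer.Properties using (pos-+; pos-*)
  open import Data.List using (map; allFin; tabulate; applyUpTo; upTo)
  open import Data.List.Properties using (map-tabulate)
  open import Data.List.Membership.Propositional using (lose)
  open import Data.List.Membership.Propositional.Properties using (∈-allFin)
  open import Data.List.Relation.Unary.Any.Properties using (any⁺)
  open import Data.Nat
    using (ℕ; zero; suc; _+_; _*_; _∸_; _⊓_; _≤_; _<_; _≤′_; ≤′-refl; ≤′-step; z≤n; s≤s; z<s; _<?_; _≡ᵇ_; ∣_-_∣; NonZero)
  open import Data.Nat.Combinatorics using (_C_; nC1≡n; nCk+nC[k+1]≡[n+1]C[k+1])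
  import Data.Nat.ListAction as List
  open import Data.Nat.Tactic.RingSolver using (solve-∀)
  open import Data.Product using (∃-syntax; _×_; _,_)
  open import Data.Rational using (toℚᵘ) renaming (_+_ to _+ℚ_; _<_ to _<ℚ_)
  open import Data.Rational.Properties using (toℚᵘ-cancel-<; toℚᵘ-homo-+; toℚᵘ-fromℚᵘ)
  open import Data.Rational.Unnormalised as ℚᵘ using (ℚᵘ; mkℚᵘ; *<*; ↥_; ↧_; _≃_)
  open import Data.Rational.Unnormalised.Properties using (≃-trans; ≃-sym; +-cong; <-respˡ-≃; <-respʳ-≃)
  open import Data.Sum using (_⊎_; inj₁; inj₂; [_,_]; [_,_]′)
  open import Function using (_∘_; const; Equivalence)
  open import Relation.Binary.PropositionalEquality
    using (_≡_; _≢_; refl; sym; trans; cong; cong₂; subst; subst₂; module ≡-Reasoning)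
  open import Relation.Nullary.Decidable using (⌊_⌋; fromWitness; yes; no)
  open import Relation.Nullary.Negation using (contradiction)

  -- Finite sums

  listSum-tabulate : ∀ {n} (f : Fin n → ℕ) → List.sum (tabulate f) ≡ sum f
  listSum-tabulate {zero}  f = refl
  listSum-tabulate {suc n} f = cong (f zero +_) (listSum-tabulate (f ∘ suc))

  listSum-map-allFin : ∀ {n} (f : Fin n → ℕ) → List.sum (map f (allFin n)) ≡ sum f
  listSum-map-allFin f = trans (cong List.sum (map-tabulate (λ i → i) f)) (listSum-tabulate f)

  listSum-upTo-≤ : ∀ n t (f : ℕ → ℕ) → (∀ s → f s ≤ 1) → (∀ s → t ≤ s → f s ≡ 0) →
                   List.sum (map f (upTo n)) ≤ t
  listSum-upTo-≤ n t f f≤1 f≡0 = go n t (λ s → s) f≤1 f≡0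
    where
    go : ∀ n t (g : ℕ → ℕ) → (∀ s → f (g s) ≤ 1) → (∀ s → t ≤ s → f (g s) ≡ 0) →
         List.sum (map f (applyUpTo g n)) ≤ t
    go zero    t       g _   _   = z≤n
    go (suc n) zero    g f≤1 f≡0 rewrite f≡0 0 z≤n = go n zero (g ∘ suc) (f≤1 ∘ suc) (λ s _ → f≡0 (suc s) z≤n)
    go (suc n) (suc t) g f≤1 f≡0 =
      +-mono-≤ (f≤1 0) (go n t (g ∘ suc) (f≤1 ∘ suc) (λ s t≤s → f≡0 (suc s) (s≤s t≤s)))

  ∑-mono-≤ : ∀ {n} {f g : Fin n → ℕ} → (∀ i → f i ≤ g i) → sum f ≤ sum g
  ∑-mono-≤ {zero}  _   = z≤n
  ∑-mono-≤ {suc n} f≤g = +-mono-≤ (f≤g zero) (∑-mono-≤ (f≤g ∘ suc))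

  ∑-const : ∀ n c → ∑[ i < n ] c ≡ n * c
  ∑-const zero    c = refl
  ∑-const (suc n) c = cong (c +_) (∑-const n c)

  ∑-↑ˡ-↑ʳ : ∀ p {q} (f : Fin (p + q) → ℕ) → sum f ≡ ∑[ i < p ] f (i ↑ˡ q) + ∑[ t < q ] f (p ↑ʳ t)
  ∑-↑ˡ-↑ʳ zero    f = refl
  ∑-↑ˡ-↑ʳ (suc p) f = trans (cong (f zero +_) (∑-↑ˡ-↑ʳ p (f ∘ suc))) (sym (+-assoc (f zero) _ _))

  ∑∑-distrib-+ : ∀ {n} (F H : Fin n → Fin n → ℕ) →
                 ∑[ u < n ] ∑[ v < n ] (F u v + H u v) ≡ ∑[ u < n ] ∑[ v < n ] F u v + ∑[ u < n ] ∑[ v < n ] H u v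
  ∑∑-distrib-+ {n} F H = trans (sum-cong-≗ λ u → ∑-distrib-+ (F u) (H u))
                               (∑-distrib-+ (λ u → ∑[ v < n ] F u v) (λ u → ∑[ v < n ] H u v))

  *-distribˡ-∑∑ : ∀ {n} c (F : Fin n → Fin n → ℕ) →
                  c * ∑[ u < n ] ∑[ v < n ] F u v ≡ ∑[ u < n ] ∑[ v < n ] (c * F u v)
  *-distribˡ-∑∑ {n} c F = trans (*-distribˡ-sum c (λ u → ∑[ v < n ] F u v)) (sum-cong-≗ λ u → *-distribˡ-sum c (F u))

  ∑∑-product : ∀ {n} (a b : Fin n → ℕ) → ∑[ u < n ] ∑[ v < n ] (a u * b v) ≡ sum a * sum b
  ∑∑-product {n} a b = begin
    ∑[ u < n ] ∑[ v < n ] (a u * b v) ≡⟨ sum-cong-≗ (λ u → *-distribˡ-sum (a u) b) ⟨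
    ∑[ u < n ] (a u * sum b)          ≡⟨ *-distribʳ-sum (sum b) a ⟨
    sum a * sum b                     ∎
    where open ≡-Reasoning

  ∑∑-pairSum : ∀ {n} (a : Fin n → ℕ) → ∑[ u < n ] ∑[ v < n ] (a u + a v) ≡ 2 * (n * sum a)
  ∑∑-pairSum {n} a = begin
    ∑[ u < n ] ∑[ v < n ] (a u + a v)       ≡⟨ sum-cong-≗ (λ u → trans (∑-distrib-+ (λ _ → a u) a)
                                                                       (cong (_+ sum a) (∑-const n (a u)))) ⟩
    ∑[ u < n ] (n * a u + sum a)            ≡⟨ ∑-distrib-+ (λ u → n * a u) (λ _ → sum a) ⟩
    ∑[ u < n ] (n * a u) + ∑[ u < n ] sum a ≡⟨ cong₂ _+_ (*-distribˡ-sum n a) (sym (∑-const n (sum a))) ⟨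
    n * sum a + n * sum a                   ≡⟨ cong (n * sum a +_) (+-identityʳ (n * sum a)) ⟨
    2 * (n * sum a)                         ∎
    where open ≡-Reasoning

  -- Walks and distances in a graph

  module _ {N} (G : Graph N) where

    reach-refl : ∀ s u → T (reach G s u u)
    reach-refl zero    u = fromWitness refl
    reach-refl (suc s) u = Equivalence.from T-∨ (inj₁ (reach-refl s u))

    reach-snoc : ∀ {s u w v} → T (reach G s u w) → T (G w v) → T (reach G (suc s) u v)
    reach-snoc {w = w} r e = Equivalence.from T-∨ (inj₂ (any⁺ _ (lose (∈-allFin w) (Equivalence.from T-∧ (r , e)))))

    reach-mono : ∀ {s t u v} → s ≤ t → T (reach G s u v) → T (reach G t u v)
    reach-mono s≤t = go (≤⇒≤′ s≤t)
      where
      go : ∀ {s t u v} → s ≤′ t → T (reach G s u v) → T (reach G t u v)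
      go ≤′-refl       r = r
      go (≤′-step s≤t) r = Equivalence.from T-∨ (inj₁ (go s≤t r))

    dist-≤ : ∀ {s u v} → T (reach G s u v) → dist G u v ≤ s
    dist-≤ {s} {u} {v} r = listSum-upTo-≤ N s (λ t → if reach G t u v then 0 else 1) unreached≤1 unreached≡0
      where
      unreached≤1 : ∀ t → (if reach G t u v then 0 else 1) ≤ 1
      unreached≤1 t with reach G t u v
      ... | true  = z≤n
      ... | false = s≤s z≤n
      unreached≡0 : ∀ t → s ≤ t → (if reach G t u v then 0 else 1) ≡ 0
      unreached≡0 t s≤t with reach G t u v | reach-mono s≤t r
      ... | true  | _  = refl
      ... | false | ()

    private
      ifLess : Fin N → Fin N → ℕ → ℕ
      ifLess u v x = if ⌊ toℕ u <? toℕ v ⌋ then x else 0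

      ifLess-mono : ∀ u v {x y} → x ≤ y → ifLess u v x ≤ ifLess u v y
      ifLess-mono u v x≤y with toℕ u <? toℕ v
      ... | yes _ = x≤y
      ... | no _  = z≤n

      ifLess-both : ∀ u v x → ifLess u v x + ifLess v u x ≤ x
      ifLess-both u v x with toℕ u <? toℕ v | toℕ v <? toℕ u
      ... | yes u<v | yes v<u = contradiction v<u (<-asym u<v)
      ... | yes _   | no _    = ≤-reflexive (+-identityʳ x)
      ... | no _    | yes _   = ≤-refl
      ... | no _    | no _    = z≤n

    wiener-≤ : (f : Fin N → Fin N → ℕ) → (∀ u v → dist G u v ≤ f u v) → (∀ u v → f u v ≡ f v u) →
               2 * wiener G ≤ ∑[ u < N ] ∑[ v < N ] f u v
    wiener-≤ f dist≤f f-sym = begin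
      2 * wiener G                                          ≡⟨ cong (2 *_) wiener≡ ⟩
      2 * ∑∑ (λ u v → ifLess u v (dist G u v))              ≤⟨ *-monoʳ-≤ 2 (∑-mono-≤ λ u → ∑-mono-≤ λ v →
                                                                                ifLess-mono u v (dist≤f u v)) ⟩
      2 * H                                                 ≡⟨ cong (H +_) (+-identityʳ H) ⟩
      H + H                                                 ≡⟨ cong (H +_) H≡ ⟩
      H + ∑∑ (λ u v → ifLess v u (f u v))                   ≡⟨ ∑∑-distrib-+ (λ u v → ifLess u v (f u v))
                                                                             (λ u v → ifLess v u (f u v)) ⟨
      ∑∑ (λ u v → ifLess u v (f u v) + ifLess v u (f u v))  ≤⟨ ∑-mono-≤ (λ u → ∑-mono-≤ λ v → ifLess-both u v (f u v)) ⟩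
      ∑∑ f                                                  ∎
      where
      open ≤-Reasoning
      ∑∑ : (Fin N → Fin N → ℕ) → ℕ
      ∑∑ F = ∑[ u < N ] ∑[ v < N ] F u v
      H : ℕ
      H = ∑∑ (λ u v → ifLess u v (f u v))
      wiener≡ : wiener G ≡ ∑∑ (λ u v → ifLess u v (dist G u v))
      wiener≡ = trans (listSum-map-allFin (λ u → List.sum (map (λ v → ifLess u v (dist G u v)) (allFin N))))
                      (sum-cong-≗ λ u → listSum-map-allFin (λ v → ifLess u v (dist G u v)))
      H≡ : H ≡ ∑∑ (λ u v → ifLess v u (f u v))
      H≡ = trans (∑-comm (λ u v → ifLess u v (f u v)))
                 (sum-cong-≗ λ u → sum-cong-≗ λ v → cong (ifLess v u) (f-sym v u))

  -- Distances in the pendant tree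

  absDiff≡∣-∣ : ∀ a b → absDiff a b ≡ ∣ a - b ∣
  absDiff≡∣-∣ zero    zero    = refl
  absDiff≡∣-∣ zero    (suc b) = refl
  absDiff≡∣-∣ (suc a) zero    = +-identityʳ (suc a)
  absDiff≡∣-∣ (suc a) (suc b) = absDiff≡∣-∣ a b

  ∣n-1+n∣≡1 : ∀ n → ∣ n - suc n ∣ ≡ 1
  ∣n-1+n∣≡1 zero    = refl
  ∣n-1+n∣≡1 (suc n) = ∣n-1+n∣≡1 n

  ∣-∣-step : ∀ {n} x y {d} → x < n → y < n → ∣ x - y ∣ ≡ suc d →
             ∃[ z ] z < n × ∣ x - z ∣ ≡ d × ∣ z - y ∣ ≡ 1
  ∣-∣-step zero    (suc y) _         y<n       refl = y , <-trans (n<1+n y) y<n , refl , ∣n-1+n∣≡1 y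
  ∣-∣-step (suc x) zero    x<n       _         refl = 1 , ≤-trans (s≤s (s≤s z≤n)) x<n , ∣-∣-identityʳ x , refl
  ∣-∣-step (suc x) (suc y) (s≤s x<n) (s≤s y<n) eq   with ∣-∣-step x y x<n y<n eq
  ... | z , z<n , ∣x-z∣≡d , ∣z-y∣≡1 = suc z , s≤s z<n , ∣x-z∣≡d , ∣z-y∣≡1

  module PendantTree (k m : ℕ) (h : Fin m → Fin (2 * k)) where

    N : ℕ
    N = 2 * k + m

    G : Graph N
    G = pendantTree k m h

    spine : Fin (2 * k) → Fin N
    spine i = i ↑ˡ m

    leaf : Fin m → Fin N
    leaf t = (2 * k) ↑ʳ t

    pos⊎ depth⊎ : Fin (2 * k) ⊎ Fin m → ℕ
    pos⊎   = [ toℕ , toℕ ∘ h ]′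
    depth⊎ = [ const 0 , const 1 ]′

    pos depth : Fin N → ℕ
    pos   = pos⊎ ∘ splitAt (2 * k)
    depth = depth⊎ ∘ splitAt (2 * k)

    distBound : Fin N → Fin N → ℕ
    distBound u v = depth u + ∣ pos u - pos v ∣ + depth v

    spine-edge : ∀ i j → ∣ toℕ i - toℕ j ∣ ≡ 1 → T (G (spine i) (spine j))
    spine-edge i j ∣i-j∣≡1 rewrite splitAt-↑ˡ (2 * k) i m | splitAt-↑ˡ (2 * k) j m
                                 | absDiff≡∣-∣ (toℕ i) (toℕ j) | ∣i-j∣≡1 = _

    spine-leaf : ∀ t → T (G (spine (h t)) (leaf t))
    spine-leaf t rewrite splitAt-↑ˡ (2 * k) (h t) m | splitAt-↑ʳ (2 * k) m t = fromWitness refl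

    leaf-spine : ∀ t → T (G (leaf t) (spine (h t)))
    leaf-spine t rewrite splitAt-↑ˡ (2 * k) (h t) m | splitAt-↑ʳ (2 * k) m t = fromWitness refl

    walk : ∀ d {a u} i j → ∣ toℕ i - toℕ j ∣ ≡ d → T (reach G a u (spine i)) → T (reach G (a + d) u (spine j))
    walk zero    {a} {u} i j ∣i-j∣≡0 r =
      subst₂ (λ s x → T (reach G s u (spine x))) (sym (+-identityʳ a)) (toℕ-injective (∣m-n∣≡0⇒m≡n ∣i-j∣≡0)) r
    walk (suc d) {a} {u} i j ∣i-j∣≡1+d r with ∣-∣-step (toℕ i) (toℕ j) (toℕ<n i) (toℕ<n j) ∣i-j∣≡1+d
    ... | z , z<2k , ∣i-z∣≡d , ∣z-j∣≡1 =
      subst (λ s → T (reach G s u (spine j))) (sym (+-suc a d))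
        (reach-snoc G {s = a + d} (walk d {a} i i′ (subst (λ x → ∣ toℕ i - x ∣ ≡ d) (sym toℕi′) ∣i-z∣≡d) r)
                                  (spine-edge i′ j (subst (λ x → ∣ x - toℕ j ∣ ≡ 1) (sym toℕi′) ∣z-j∣≡1)))
      where
      i′ : Fin (2 * k)
      i′ = fromℕ< z<2k
      toℕi′ : toℕ i′ ≡ z
      toℕi′ = toℕ-fromℕ< z<2k

    reach-distBound : ∀ u v → T (reach G (distBound u v) u v)
    reach-distBound u v = subst₂ (λ x y → T (reach G (distBound u v) x y))
                            (join-splitAt (2 * k) m u) (join-splitAt (2 * k) m v)
                            (reach-distBound⊎ (splitAt (2 * k) u) (splitAt (2 * k) v))
      where
      cast : ∀ {s t u v} → s ≡ t → T (reach G s u v) → T (reach G t u v)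
      cast {u = u} {v} = subst (λ s → T (reach G s u v))

      from-spine : ∀ i → T (reach G 0 (spine i) (spine i))
      from-spine i = reach-refl G 0 (spine i)

      from-leaf : ∀ t → T (reach G 1 (leaf t) (spine (h t)))
      from-leaf t = reach-snoc G {s = 0} (reach-refl G 0 (leaf t)) (leaf-spine t)

      reach-distBound⊎ : ∀ x y → T (reach G (depth⊎ x + ∣ pos⊎ x - pos⊎ y ∣ + depth⊎ y)
                                            (join (2 * k) m x) (join (2 * k) m y))
      reach-distBound⊎ (inj₁ i) (inj₁ j) =
        cast (sym (+-identityʳ ∣ toℕ i - toℕ j ∣)) (walk _ {0} i j refl (from-spine i))
      reach-distBound⊎ (inj₁ i) (inj₂ t) =
        cast (+-comm 1 ∣ toℕ i - toℕ (h t) ∣)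
             (reach-snoc G {s = ∣ toℕ i - toℕ (h t) ∣} (walk _ {0} i (h t) refl (from-spine i)) (spine-leaf t))
      reach-distBound⊎ (inj₂ s) (inj₁ j) =
        cast (sym (+-identityʳ (1 + ∣ toℕ (h s) - toℕ j ∣))) (walk _ {1} (h s) j refl (from-leaf s))
      reach-distBound⊎ (inj₂ s) (inj₂ t) =
        cast (+-comm 1 (1 + ∣ toℕ (h s) - toℕ (h t) ∣))
             (reach-snoc G {s = 1 + ∣ toℕ (h s) - toℕ (h t) ∣} (walk _ {1} (h s) (h t) refl (from-leaf s))
                         (spine-leaf t))

    distBound-sym : ∀ u v → distBound u v ≡ distBound v u
    distBound-sym u v =
      trans (cong (λ d → depth u + d + depth v) (∣-∣-comm (pos u) (pos v))) (swap (depth u) _ (depth v))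
      where
      swap : ∀ a d b → a + d + b ≡ b + d + a
      swap = solve-∀

    wiener-≤-distBound : 2 * wiener G ≤ ∑[ u < N ] ∑[ v < N ] distBound u v
    wiener-≤-distBound = wiener-≤ G distBound (λ u v → dist-≤ G (reach-distBound u v)) distBound-sym

    pos-spine : ∀ i → pos (spine i) ≡ toℕ i
    pos-spine i = cong pos⊎ (splitAt-↑ˡ (2 * k) i m)

    pos-leaf : ∀ t → pos (leaf t) ≡ toℕ (h t)
    pos-leaf t = cong pos⊎ (splitAt-↑ʳ (2 * k) m t)

    ∑-pos : ∀ (f : ℕ → ℕ) → ∑[ u < N ] f (pos u) ≡ ∑[ i < 2 * k ] f (toℕ i) + ∑[ t < m ] f (toℕ (h t))
    ∑-pos f = trans (∑-↑ˡ-↑ʳ (2 * k) (f ∘ pos))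
                    (cong₂ _+_ (sum-cong-≗ (cong f ∘ pos-spine)) (sum-cong-≗ (cong f ∘ pos-leaf)))

    ∑-depth : ∑[ u < N ] depth u ≡ m
    ∑-depth = begin
      ∑[ u < N ] depth u                                         ≡⟨ ∑-↑ˡ-↑ʳ (2 * k) depth ⟩
      ∑[ i < 2 * k ] depth (spine i) + ∑[ t < m ] depth (leaf t) ≡⟨ cong₂ _+_ (sum-cong-≗ depth-spine)
                                                                                (sum-cong-≗ depth-leaf) ⟩
      ∑[ i < 2 * k ] 0 + ∑[ t < m ] 1                            ≡⟨ cong₂ _+_ (sum-replicate-zero (2 * k)) (∑-const m 1) ⟩
      m * 1                                                      ≡⟨ *-identityʳ m ⟩
      m                                                          ∎
      where
      open ≡-Reasoning
      depth-spine : ∀ i → depth (spine i) ≡ 0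
      depth-spine i = cong depth⊎ (splitAt-↑ˡ (2 * k) i m)
      depth-leaf : ∀ t → depth (leaf t) ≡ 1
      depth-leaf t = cong depth⊎ (splitAt-↑ʳ (2 * k) m t)

  -- Geodesics through v₃

  -- Written as in attachedTo, so that attachedTo h 0 is the sum of isZero ∘ toℕ ∘ h.
  isZero : ℕ → ℕ
  isZero x = if x ≡ᵇ 0 then 1 else 0

  isAtMostOne : ℕ → ℕ
  isAtMostOne zero          = 1
  isAtMostOne (suc zero)    = 1
  isAtMostOne (suc (suc _)) = 0

  isAtMostOne≡isZero : ∀ {x} → x ≢ 1 → isAtMostOne x ≡ isZero x
  isAtMostOne≡isZero {zero}        _   = refl
  isAtMostOne≡isZero {suc zero}    x≢1 = contradiction refl x≢1
  isAtMostOne≡isZero {suc (suc _)} _   = refl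

  ∣2-x∣-split : ∀ x → ∣ 2 - x ∣ ≡ (x ∸ 2) + isZero x + isAtMostOne x
  ∣2-x∣-split zero          = refl
  ∣2-x∣-split (suc zero)    = refl
  ∣2-x∣-split (suc (suc y)) = sym (trans (+-identityʳ (y + 0)) (+-identityʳ y))

  -- On the path 0 – 1 – 2 – ⋯ the geodesics from x and from y to 2 share sharedLength x y edges.
  sharedLength : ℕ → ℕ → ℕ
  sharedLength x y = isZero x * isZero y + isAtMostOne x * isAtMostOne y + (x ∸ 2) ⊓ (y ∸ 2)

  2*[m⊓n]+∣m-n∣≡m+n : ∀ m n → 2 * (m ⊓ n) + ∣ m - n ∣ ≡ m + n
  2*[m⊓n]+∣m-n∣≡m+n zero    zero    = refl
  2*[m⊓n]+∣m-n∣≡m+n zero    (suc n) = refl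
  2*[m⊓n]+∣m-n∣≡m+n (suc m) zero    = sym (+-identityʳ (suc m))
  2*[m⊓n]+∣m-n∣≡m+n (suc m) (suc n) = begin
    2 * suc (m ⊓ n) + ∣ m - n ∣   ≡⟨ shift (m ⊓ n) ∣ m - n ∣ ⟩
    2 + (2 * (m ⊓ n) + ∣ m - n ∣) ≡⟨ cong (2 +_) (2*[m⊓n]+∣m-n∣≡m+n m n) ⟩
    2 + (m + n)                   ≡⟨ cong suc (+-suc m n) ⟨
    suc m + suc n                 ∎
    where
    open ≡-Reasoning
    shift : ∀ a d → 2 * suc a + d ≡ 2 + (2 * a + d)
    shift = solve-∀

  detour-via-2 : ∀ x y → 2 * sharedLength x y + ∣ x - y ∣ ≡ ∣ 2 - x ∣ + ∣ 2 - y ∣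
  detour-via-2 zero          zero          = refl
  detour-via-2 zero          (suc zero)    = refl
  detour-via-2 zero          (suc (suc y)) = refl
  detour-via-2 (suc zero)    zero          = refl
  detour-via-2 (suc zero)    (suc zero)    = refl
  detour-via-2 (suc zero)    (suc (suc y)) = refl
  detour-via-2 (suc (suc x)) zero          rewrite ⊓-zeroʳ x = +-comm 2 x
  detour-via-2 (suc (suc x)) (suc zero)    rewrite ⊓-zeroʳ x = +-comm 1 x
  detour-via-2 (suc (suc x)) (suc (suc y)) = 2*[m⊓n]+∣m-n∣≡m+n x y

  m*n≤o*[m⊓n] : ∀ {m n o} → m ≤ o → n ≤ o → m * n ≤ o * (m ⊓ n)
  m*n≤o*[m⊓n] {m} {n} {o} m≤o n≤o with ≤-total m n
  ... | inj₁ m≤n rewrite m≤n⇒m⊓n≡m m≤n = ≤-trans (*-monoʳ-≤ m n≤o) (≤-reflexive (*-comm m o))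
  ... | inj₂ n≤m rewrite m≥n⇒m⊓n≡n n≤m = *-monoˡ-≤ n m≤o

  centre-pair : ∀ l x y d e → x ∸ 2 ≤ l → y ∸ 2 ≤ l →
    l * (d + ∣ x - y ∣ + e) + 2 * l * (isZero x * isZero y + isAtMostOne x * isAtMostOne y) + 2 * ((x ∸ 2) * (y ∸ 2))
    ≤ l * ((d + ∣ 2 - x ∣) + (e + ∣ 2 - y ∣))
  centre-pair l x y d e x∸2≤l y∸2≤l = begin
    l * (d + D + e) + 2 * l * I + 2 * ((x ∸ 2) * (y ∸ 2)) ≤⟨ +-monoʳ-≤ (l * (d + D + e) + 2 * l * I)
                                                               (*-monoʳ-≤ 2 (m*n≤o*[m⊓n] x∸2≤l y∸2≤l)) ⟩
    l * (d + D + e) + 2 * l * I + 2 * (l * M)             ≡⟨ regroup l d e D I M ⟩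
    l * (d + e + (2 * sharedLength x y + D))              ≡⟨ cong (λ z → l * (d + e + z)) (detour-via-2 x y) ⟩
    l * (d + e + (φx + φy))                               ≡⟨ interleave l d e φx φy ⟩
    l * ((d + φx) + (e + φy))                             ∎
    where
    open ≤-Reasoning
    D φx φy I M : ℕ
    D  = ∣ x - y ∣
    φx = ∣ 2 - x ∣
    φy = ∣ 2 - y ∣
    I  = isZero x * isZero y + isAtMostOne x * isAtMostOne y
    M  = (x ∸ 2) ⊓ (y ∸ 2)
    regroup : ∀ l d e D I M → l * (d + D + e) + 2 * l * I + 2 * (l * M) ≡ l * (d + e + (2 * (I + M) + D))
    regroup = solve-∀
    interleave : ∀ l d e p q → l * (d + e + (p + q)) ≡ l * ((d + p) + (e + q))
    interleave = solve-∀

  private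
    2*m*n≤m*m+n*n-≤ : ∀ {m n} → m ≤ n → 2 * (m * n) ≤ m * m + n * n
    2*m*n≤m*m+n*n-≤ {m} m≤n with m≤n⇒∃[o]m+o≡n m≤n
    ... | d , refl = subst (2 * (m * (m + d)) ≤_) (square m d) (m≤m+n _ (d * d))
      where
      square : ∀ m d → 2 * (m * (m + d)) + d * d ≡ m * m + (m + d) * (m + d)
      square = solve-∀

  2*m*n≤m*m+n*n : ∀ m n → 2 * (m * n) ≤ m * m + n * n
  2*m*n≤m*m+n*n m n with ≤-total m n
  ... | inj₁ m≤n = 2*m*n≤m*m+n*n-≤ m≤n
  ... | inj₂ n≤m = subst₂ _≤_ (cong (2 *_) (*-comm n m)) (+-comm (n * n) (m * m)) (2*m*n≤m*m+n*n-≤ n≤m)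

  amgm-eliminate : ∀ l n G R Y Q → .{{NonZero l}} →
                   l * G + 2 * l * R + 2 * (Y * Y) ≤ l * (2 * (n * (Y + Q))) →
                   2 * G + 4 * R ≤ l * n * n + 4 * n * Q
  amgm-eliminate l n G R Y Q hyp = *-cancelˡ-≤ l (+-cancelʳ-≤ (2 * Y * (2 * Y)) _ _ (begin
    l * (2 * G + 4 * R) + 2 * Y * (2 * Y)               ≡⟨ double l G R Y ⟩
    2 * (l * G + 2 * l * R + 2 * (Y * Y))               ≤⟨ *-monoʳ-≤ 2 hyp ⟩
    2 * (l * (2 * (n * (Y + Q))))                       ≡⟨ expand l n Y Q ⟩
    2 * (l * n * (2 * Y)) + l * (4 * n * Q)             ≤⟨ +-monoˡ-≤ (l * (4 * n * Q)) (2*m*n≤m*m+n*n (l * n) (2 * Y)) ⟩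
    l * n * (l * n) + 2 * Y * (2 * Y) + l * (4 * n * Q) ≡⟨ collect l n Y Q ⟩
    l * (l * n * n + 4 * n * Q) + 2 * Y * (2 * Y)       ∎))
    where
    open ≤-Reasoning
    double : ∀ l G R Y → l * (2 * G + 4 * R) + 2 * Y * (2 * Y) ≡ 2 * (l * G + 2 * l * R + 2 * (Y * Y))
    double = solve-∀
    expand : ∀ l n Y Q → 2 * (l * (2 * (n * (Y + Q)))) ≡ 2 * (l * n * (2 * Y)) + l * (4 * n * Q)
    expand = solve-∀
    collect : ∀ l n Y Q →
              l * n * (l * n) + 2 * Y * (2 * Y) + l * (4 * n * Q) ≡ l * (l * n * n + 4 * n * Q) + 2 * Y * (2 * Y)
    collect = solve-∀

  ∑-isZero : ∀ n → ∑[ i < suc n ] isZero (toℕ i) ≡ 1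
  ∑-isZero n = cong suc (sum-replicate-zero n)

  ∑-isAtMostOne : ∀ n → ∑[ i < 2 + n ] isAtMostOne (toℕ i) ≡ 2
  ∑-isAtMostOne n = cong (2 +_) (sum-replicate-zero n)

  module Centre (j m : ℕ) (h : Fin m → Fin (2 * (2 + j))) where
    open PendantTree (2 + j) m h public

    l : ℕ
    l = 1 + 2 * j

    a : ℕ
    a = attachedTo {2 + j} {m} h 0

    toV₃ : Fin N → ℕ
    toV₃ u = depth u + ∣ 2 - pos u ∣

    Y P₀ P₁ Gs : ℕ
    Y  = ∑[ u < N ] (pos u ∸ 2)
    P₀ = ∑[ u < N ] isZero (pos u)
    P₁ = ∑[ u < N ] isAtMostOne (pos u)
    Gs = ∑[ u < N ] ∑[ v < N ] distBound u v

    pos∸2≤l : ∀ u → pos u ∸ 2 ≤ l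
    pos∸2≤l u = ∸-monoˡ-≤ 2 (≤-pred (subst (pos u <_) (2k≡ j) (pos<2k (splitAt (2 * (2 + j)) u))))
      where
      2k≡ : ∀ j → 2 * (2 + j) ≡ 4 + 2 * j
      2k≡ = solve-∀
      pos<2k : ∀ x → pos⊎ x < 2 * (2 + j)
      pos<2k = [ toℕ<n , toℕ<n ∘ h ]

    ∑∑-centre-pair : l * Gs + 2 * l * (P₀ * P₀ + P₁ * P₁) + 2 * (Y * Y) ≤ l * (2 * (N * ∑[ u < N ] toV₃ u))
    ∑∑-centre-pair = begin
      l * Gs + 2 * l * (P₀ * P₀ + P₁ * P₁) + 2 * (Y * Y)
        ≡⟨ lhs≡ ⟩
      ∑[ u < N ] ∑[ v < N ] (l * distBound u v + 2 * l * I u v + 2 * (ŷ u * ŷ v))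
        ≤⟨ ∑-mono-≤ (λ u → ∑-mono-≤ λ v →
             centre-pair l (pos u) (pos v) (depth u) (depth v) (pos∸2≤l u) (pos∸2≤l v)) ⟩
      ∑[ u < N ] ∑[ v < N ] (l * (toV₃ u + toV₃ v))
        ≡⟨ *-distribˡ-∑∑ l (λ u v → toV₃ u + toV₃ v) ⟨
      l * ∑[ u < N ] ∑[ v < N ] (toV₃ u + toV₃ v)
        ≡⟨ cong (l *_) (∑∑-pairSum toV₃) ⟩
      l * (2 * (N * ∑[ u < N ] toV₃ u))
        ∎
      where
      open ≤-Reasoning
      ŷ : Fin N → ℕ
      ŷ u = pos u ∸ 2
      I : Fin N → Fin N → ℕ
      I u v = isZero (pos u) * isZero (pos v) + isAtMostOne (pos u) * isAtMostOne (pos v)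
      ∑∑I : ∑[ u < N ] ∑[ v < N ] I u v ≡ P₀ * P₀ + P₁ * P₁
      ∑∑I = trans (∑∑-distrib-+ (λ u v → isZero (pos u) * isZero (pos v))
                                (λ u v → isAtMostOne (pos u) * isAtMostOne (pos v)))
                  (cong₂ _+_ (∑∑-product (isZero ∘ pos) (isZero ∘ pos))
                             (∑∑-product (isAtMostOne ∘ pos) (isAtMostOne ∘ pos)))
      lhs≡ : l * Gs + 2 * l * (P₀ * P₀ + P₁ * P₁) + 2 * (Y * Y)
             ≡ ∑[ u < N ] ∑[ v < N ] (l * distBound u v + 2 * l * I u v + 2 * (ŷ u * ŷ v))
      lhs≡ = sym (begin-equality
        ∑[ u < N ] ∑[ v < N ] (l * distBound u v + 2 * l * I u v + 2 * (ŷ u * ŷ v))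
          ≡⟨ ∑∑-distrib-+ (λ u v → l * distBound u v + 2 * l * I u v) (λ u v → 2 * (ŷ u * ŷ v)) ⟩
        ∑[ u < N ] ∑[ v < N ] (l * distBound u v + 2 * l * I u v) + ∑[ u < N ] ∑[ v < N ] (2 * (ŷ u * ŷ v))
          ≡⟨ cong₂ _+_ (∑∑-distrib-+ (λ u v → l * distBound u v) (λ u v → 2 * l * I u v))
                       (sym (*-distribˡ-∑∑ 2 (λ u v → ŷ u * ŷ v))) ⟩
        ∑[ u < N ] ∑[ v < N ] (l * distBound u v) + ∑[ u < N ] ∑[ v < N ] (2 * l * I u v)
          + 2 * ∑[ u < N ] ∑[ v < N ] (ŷ u * ŷ v)
          ≡⟨ cong₂ (λ x y → x + y + 2 * ∑[ u < N ] ∑[ v < N ] (ŷ u * ŷ v))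
                   (*-distribˡ-∑∑ l distBound) (*-distribˡ-∑∑ (2 * l) I) ⟨
        l * Gs + 2 * l * ∑[ u < N ] ∑[ v < N ] I u v + 2 * ∑[ u < N ] ∑[ v < N ] (ŷ u * ŷ v)
          ≡⟨ cong₂ (λ x y → l * Gs + 2 * l * x + 2 * y) ∑∑I (∑∑-product ŷ ŷ) ⟩
        l * Gs + 2 * l * (P₀ * P₀ + P₁ * P₁) + 2 * (Y * Y) ∎)

    ∑toV₃≡Y+P₀+P₁+m : ∑[ u < N ] toV₃ u ≡ Y + (P₀ + P₁ + m)
    ∑toV₃≡Y+P₀+P₁+m = begin
      ∑[ u < N ] (depth u + ∣ 2 - pos u ∣)          ≡⟨ ∑-distrib-+ depth (λ u → ∣ 2 - pos u ∣) ⟩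
      ∑[ u < N ] depth u + ∑[ u < N ] ∣ 2 - pos u ∣ ≡⟨ cong₂ _+_ ∑-depth (sum-cong-≗ (∣2-x∣-split ∘ pos)) ⟩
      m + ∑[ u < N ] ((pos u ∸ 2) + isZero (pos u) + isAtMostOne (pos u))
        ≡⟨ cong (m +_) (trans (∑-distrib-+ (λ u → (pos u ∸ 2) + isZero (pos u)) (isAtMostOne ∘ pos))
                              (cong (_+ P₁) (∑-distrib-+ (λ u → pos u ∸ 2) (isZero ∘ pos)))) ⟩
      m + (Y + P₀ + P₁)                             ≡⟨ rotate m Y P₀ P₁ ⟩
      Y + (P₀ + P₁ + m)                             ∎
      where
      open ≡-Reasoning
      rotate : ∀ m y p q → m + (y + p + q) ≡ y + (p + q + m)
      rotate = solve-∀

    P₀≡1+a : P₀ ≡ 1 + a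
    P₀≡1+a = trans (∑-pos isZero)
      (cong₂ _+_ (∑-isZero (2 * (2 + j) ∸ 1)) (sym (listSum-map-allFin (isZero ∘ toℕ ∘ h))))

    P₁≡2+a : (∀ t → toℕ (h t) ≢ 1) → P₁ ≡ 2 + a
    P₁≡2+a v₂-bare = trans (∑-pos isAtMostOne)
      (cong₂ _+_ (∑-isAtMostOne (2 * (2 + j) ∸ 2))
                 (trans (sum-cong-≗ (isAtMostOne≡isZero ∘ v₂-bare)) (sym (listSum-map-allFin (isZero ∘ toℕ ∘ h)))))

    transmission-bound : (∀ t → toℕ (h t) ≢ 1) →
      4 * wiener G + 4 * ((1 + a) * (1 + a) + (2 + a) * (2 + a)) ≤ l * N * N + 4 * N * ((1 + a) + (2 + a) + m)
    transmission-bound v₂-bare =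
      subst₂ (λ p q → 4 * wiener G + 4 * (p * p + q * q) ≤ l * N * N + 4 * N * (p + q + m))
             P₀≡1+a (P₁≡2+a v₂-bare) (begin
        4 * wiener G + 4 * R               ≡⟨ cong (_+ 4 * R) (*-assoc 2 2 (wiener G)) ⟩
        2 * (2 * wiener G) + 4 * R         ≤⟨ +-monoˡ-≤ (4 * R) (*-monoʳ-≤ 2 wiener-≤-distBound) ⟩
        2 * Gs + 4 * R                     ≤⟨ amgm-eliminate l N Gs R Y (P₀ + P₁ + m)
                                                (subst (λ σ → l * Gs + 2 * l * R + 2 * (Y * Y) ≤ l * (2 * (N * σ)))
                                                       ∑toV₃≡Y+P₀+P₁+m ∑∑-centre-pair) ⟩
        l * N * N + 4 * N * (P₀ + P₁ + m) ∎)
      where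
      open ≤-Reasoning
      R : ℕ
      R = P₀ * P₀ + P₁ * P₁

  -- The final estimate

  <-by-slack : ∀ {x y e} → x + suc e ≡ y → x < y
  <-by-slack {x} eq = subst (x <_) eq (m<m+n x z<s)

  -- k = 2 + j keeps 2k − 3 = 1 + 2j and k − 1 = 1 + j free of truncated subtraction; n − 1 = 3 + 2j + m.
  QuadraticBound : ℕ → ℕ → ℕ → Set
  QuadraticBound j a m =
    let k = 2 + j; n = 2 * k + m in
    k * k * ((1 + 2 * j) * n * n + 4 * n * ((1 + a) + (2 + a) + m))
    < 4 * (k * k) * ((1 + a) * (1 + a) + (2 + a) * (2 + a))
      + ((k * 2 + 1) * (k * k) + 4 * (1 + j) * 2) * (n * (3 + 2 * j + m))

  -- As a function of t = k·a the gap is a quadratic that decreases on 0 ≤ t ≤ m + 1.  The slack is its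
  -- value n(6j³ + 39j² + 60j + 36) + 4j² + 8j + 8 at t = m + 1, plus 8s(jn + j + s) for s = m + 1 − t.
  quadratic-bound : ∀ j a m → (2 + j) * a ≤ m + 1 → QuadraticBound j a m
  quadratic-bound j zero    m _      = <-by-slack (certificate j m)
    where
    certificate : ∀ j m → let k = 2 + j; n = 2 * k + m; s = 1 + m in
      k * k * ((1 + 2 * j) * n * n + 4 * n * ((1 + 0) + (2 + 0) + m))
      + (8 + 8 * j + 4 * (j * j) + n * (36 + 60 * j + 39 * (j * j) + 6 * (j * j * j)) + 8 * s * (j * n + j + s))
      ≡ 4 * (k * k) * ((1 + 0) * (1 + 0) + (2 + 0) * (2 + 0))
        + ((k * 2 + 1) * (k * k) + 4 * (1 + j) * 2) * (n * (3 + 2 * j + m))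
    certificate = solve-∀
  quadratic-bound j (suc b) m ka≤m+1 with m≤n⇒∃[o]m+o≡n ka≤m+1
  ... | s , ka+s≡m+1 = subst (QuadraticBound j (suc b)) m≡ (<-by-slack (certificate j b s))
    where
    m≡ : (2 + j) * b + (1 + j) + s ≡ m
    m≡ = +-cancelʳ-≡ 1 _ _ (trans (shift j b s) ka+s≡m+1)
      where
      shift : ∀ j b s → (2 + j) * b + (1 + j) + s + 1 ≡ (2 + j) * suc b + s
      shift = solve-∀
    certificate : ∀ j b s → let k = 2 + j; m = k * b + (1 + j) + s; n = 2 * k + m; a = suc b in
      k * k * ((1 + 2 * j) * n * n + 4 * n * ((1 + a) + (2 + a) + m))
      + (8 + 8 * j + 4 * (j * j) + n * (36 + 60 * j + 39 * (j * j) + 6 * (j * j * j)) + 8 * s * (j * n + j + s))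
      ≡ 4 * (k * k) * ((1 + a) * (1 + a) + (2 + a) * (2 + a))
        + ((k * 2 + 1) * (k * k) + 4 * (1 + j) * 2) * (n * (3 + 2 * j + m))
    certificate = solve-∀

  2*nC2≡n*[n∸1] : ∀ n → 2 * (n C 2) ≡ n * (n ∸ 1)
  2*nC2≡n*[n∸1] zero    = refl
  2*nC2≡n*[n∸1] (suc n) = begin
    2 * (suc n C 2)     ≡⟨ cong (2 *_) (nCk+nC[k+1]≡[n+1]C[k+1] n 1) ⟨
    2 * (n C 1 + n C 2) ≡⟨ cong (λ c → 2 * (c + n C 2)) (nC1≡n n) ⟩
    2 * (n + n C 2)     ≡⟨ *-distribˡ-+ 2 n (n C 2) ⟩
    2 * n + 2 * (n C 2) ≡⟨ cong (2 * n +_) (2*nC2≡n*[n∸1] n) ⟩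
    2 * n + n * (n ∸ 1) ≡⟨ complete n ⟩
    suc n * n           ∎
    where
    open ≡-Reasoning
    square : ∀ n → 2 * suc n + suc n * n ≡ suc (suc n) * suc n
    square = solve-∀
    complete : ∀ n → 2 * n + n * (n ∸ 1) ≡ suc n * n
    complete zero    = refl
    complete (suc n) = square n

  mean-bound : ∀ j a m W → (2 + j) * a ≤ m + 1 →
    let k = 2 + j; n = 2 * k + m; R = (1 + a) * (1 + a) + (2 + a) * (2 + a) in
    4 * W + 4 * R ≤ (1 + 2 * j) * n * n + 4 * n * ((1 + a) + (2 + a) + m) →
    W * (2 * (k * k)) < ((k * 2 + 1) * (k * k) + 4 * (1 + j) * 2) * (n C 2)
  mean-bound j a m W ka≤m+1 4W+4R≤ = *-cancelˡ-< 2 _ _ (+-cancelʳ-< (4 * (k * k) * R) _ _ (begin-strict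
    2 * (W * (2 * (k * k))) + 4 * (k * k) * R                        ≡⟨ factor (k * k) W R ⟩
    k * k * (4 * W + 4 * R)                                          ≤⟨ *-monoʳ-≤ (k * k) 4W+4R≤ ⟩
    k * k * ((1 + 2 * j) * n * n + 4 * n * ((1 + a) + (2 + a) + m)) <⟨ quadratic-bound j a m ka≤m+1 ⟩
    4 * (k * k) * R + c * (n * (3 + 2 * j + m))                      ≡⟨ cong (λ x → 4 * (k * k) * R + c * (n * x)) n∸1≡ ⟨
    4 * (k * k) * R + c * (n * (n ∸ 1))                              ≡⟨ cong (λ x → 4 * (k * k) * R + c * x)
                                                                             (2*nC2≡n*[n∸1] n) ⟨
    4 * (k * k) * R + c * (2 * (n C 2))                              ≡⟨ swap (4 * (k * k) * R) c (n C 2) ⟩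
    2 * (c * (n C 2)) + 4 * (k * k) * R                              ∎))
    where
    open ≤-Reasoning
    k n R c : ℕ
    k = 2 + j
    n = 2 * k + m
    R = (1 + a) * (1 + a) + (2 + a) * (2 + a)
    c = (k * 2 + 1) * (k * k) + 4 * (1 + j) * 2
    n≡ : ∀ j m → 2 * (2 + j) + m ≡ 4 + 2 * j + m
    n≡ = solve-∀
    n∸1≡ : n ∸ 1 ≡ 3 + 2 * j + m
    n∸1≡ = cong (_∸ 1) (n≡ j m)
    factor : ∀ K W R → 2 * (W * (2 * K)) + 4 * K * R ≡ K * (4 * W + 4 * R)
    factor = solve-∀
    swap : ∀ x c b → x + c * (2 * b) ≡ 2 * (c * b) + x
    swap = solve-∀

  //-<-bound : ∀ K F d W c → W * (2 * suc d) < ((K * 2 + 1) * suc d + F * 2) * c →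
              W // c <ℚ (K // 1 +ℚ 1 // 2) +ℚ F // suc d
  //-<-bound K F d W zero    lt =
    contradiction (subst (W * (2 * suc d) <_) (*-zeroʳ ((K * 2 + 1) * suc d + F * 2)) lt) n≮0
  //-<-bound K F d W (suc c) lt =
    toℚᵘ-cancel-< (<-respʳ-≃ (≃-sym rhs≃) (<-respˡ-≃ (≃-sym (toℚᵘ-fromℚᵘ w)) (*<* ↥w↧r<↥r↧w)))
    where
    w r : ℚᵘ
    w = mkℚᵘ (ℤ.+ W) c
    r = (mkℚᵘ (ℤ.+ K) 0 ℚᵘ.+ mkℚᵘ (ℤ.+ 1) 1) ℚᵘ.+ mkℚᵘ (ℤ.+ F) d
    rhs≃ : toℚᵘ ((K // 1 +ℚ 1 // 2) +ℚ F // suc d) ≃ r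
    rhs≃ = ≃-trans (toℚᵘ-homo-+ (K // 1 +ℚ 1 // 2) (F // suc d))
             (+-cong (≃-trans (toℚᵘ-homo-+ (K // 1) (1 // 2))
                              (+-cong (toℚᵘ-fromℚᵘ (mkℚᵘ (ℤ.+ K) 0)) (toℚᵘ-fromℚᵘ (mkℚᵘ (ℤ.+ 1) 1))))
                     (toℚᵘ-fromℚᵘ (mkℚᵘ (ℤ.+ F) d)))
    ↥r≡ : ↥ r ≡ ℤ.+ ((K * 2 + 1) * suc d + F * 2)
    ↥r≡ = sym (begin
      ℤ.+ ((K * 2 + 1) * suc d + F * 2)                 ≡⟨ pos-+ ((K * 2 + 1) * suc d) (F * 2) ⟩
      ℤ.+ ((K * 2 + 1) * suc d) ℤ.+ ℤ.+ (F * 2)         ≡⟨ cong₂ ℤ._+_ (pos-* (K * 2 + 1) (suc d)) (pos-* F 2) ⟩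
      ℤ.+ (K * 2 + 1) ℤ.* ℤ.+ suc d ℤ.+ ℤ.+ F ℤ.* ℤ.+ 2 ≡⟨ cong (λ x → x ℤ.* ℤ.+ suc d ℤ.+ ℤ.+ F ℤ.* ℤ.+ 2)
                                                           (trans (pos-+ (K * 2) 1) (cong (ℤ._+ ℤ.+ 1) (pos-* K 2))) ⟩
      ↥ r                                               ∎)
      where open ≡-Reasoning
    ↥w↧r<↥r↧w : ↥ w ℤ.* ↧ r ℤ.< ↥ r ℤ.* ↧ w
    ↥w↧r<↥r↧w = subst₂ ℤ._<_ (pos-* W (2 * suc d))
                  (trans (pos-* ((K * 2 + 1) * suc d + F * 2) (suc c)) (cong (ℤ._* ℤ.+ suc c) (sym ↥r≡)))
                  (+<+ lt)

open import Defs
open import Data.Nat using (ℕ; _+_; _*_; _∸_; _≤_)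
open import Relation.Binary.PropositionalEquality using (_≢_)
open import Data.Fin using (Fin; toℕ)
open import Data.Rational using (_<_) renaming (_+_ to _+ℚ_)
open import Data.Nat using (suc; s≤s; z≤n)
open import Data.Nat.Combinatorics using (_C_)

lemma5p4 : (k m : ℕ) → 2 ≤ k → (h : Fin m → Fin (2 * k)) →
    (∀ t → toℕ (h t) ≢ 1) →
    k * attachedTo {k} {m} h 0 ≤ m + 1 →
    μ (pendantTree k m h) < ((k // 1 +ℚ 1 // 2) +ℚ (4 * (k ∸ 1)) // (k * k))
lemma5p4 (suc (suc j)) m (s≤s (s≤s z≤n)) h v₂-bare few =
  //-<-bound (2 + j) (4 * (1 + j)) _ (wiener G) (N C 2)
    (mean-bound j a m (wiener G) few (transmission-bound v₂-bare))
  where open Centre j m h
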